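{- Let $\mathbf A$ be a Łukasiewicz near semiring and $I,J$ ideals of $\mathbf A$. Then $\langle I\cup J\rangle=[I]_{\theta(J)}$, where $[I]_{\theta(J)}=\{a\in A: (a,i)\in\theta(J)\text{ for some } i\in I\}$ and $a\,\theta(J)\,b$ iff $a^{\alpha}b,\,b^{\alpha}a\in J$.
   Context: An $\iota$-near semiring is an algebra $\langle A,+,\cdot,{}^{\alpha},0,1\rangle$ of type $\langle 2,2,1,0,0\rangle$ such that $\langle A,+\rangle$ is a join semilattice with least element $0$ and greatest element $1$ (order $x\le y$ iff $x+y=y$), $x\cdot1=x=1\cdot x$, $(x+y)\cdot z=xz+yz$, $x0=0x=0$, $(x^{\alpha})^{\alpha}=x$, and $x\le y$ implies $y^{\alpha}\le x^{\alpha}$. A Łukasiewicz near semiring is an $\iota$-near semiring satisfying $(x y^{\alpha})^{\alpha} y^{\alpha}=(y x^{\alpha})^{\alpha} x^{\alpha}$. Juxtaposition $xy$ denotes $x\cdot y$. An ideal of $\mathbf A$ is a set $I\subseteq A$ with $0\in I$ such that (I1) if $ab^{\alpha}\in I$ and $b\in I$ then $a\in I$; (I2) if $a^{\alpha}b\in I$ and $b^{\alpha}a\in I$ then $(ac)^{\alpha}(bc)\in I$ and $(ca)^{\alpha}(cb)\in I$ for every $c\in A$. $\langle X\rangle$ denotes the least ideal containing $X$. -}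

module Defs where

open import Level using (Level; suc; _⊔_)
open import Relation.Binary.PropositionalEquality using (_≡_)
open import Relation.Unary using (Pred; _∈_; _⊆_; _∪_)
open import Data.Product using (_×_; ∃-syntax)

record IotaNearSemiring (a : Level) : Set (suc a) where
  infixl 6 _+_
  infixl 7 _·_
  infix  8 _ᵅ
  infix  4 _≤_
  field
    Carrier : Set a
    _+_     : Carrier → Carrier → Carrier
    _·_     : Carrier → Carrier → Carrier
    _ᵅ      : Carrier → Carrier
    𝟘       : Carrier
    𝟙       : Carrier

  _≤_ : Carrier → Carrier → Set a
  x ≤ y = x + y ≡ y

  field
    +-assoc   : ∀ x y z → (x + y) + z ≡ x + (y + z)
    +-comm    : ∀ x y → x + y ≡ y + x
    +-idem    : ∀ x → x + x ≡ x
    +-identity : ∀ x → x + 𝟘 ≡ x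
    +-top     : ∀ x → x + 𝟙 ≡ 𝟙
    ·-identityʳ : ∀ x → x · 𝟙 ≡ x
    ·-identityˡ : ∀ x → 𝟙 · x ≡ x
    ·-distribʳ  : ∀ x y z → (x + y) · z ≡ x · z + y · z
    ·-zeroʳ     : ∀ x → x · 𝟘 ≡ 𝟘
    ·-zeroˡ     : ∀ x → 𝟘 · x ≡ 𝟘
    ᵅ-invol     : ∀ x → (x ᵅ) ᵅ ≡ x
    ᵅ-antitone  : ∀ {x y} → x ≤ y → y ᵅ ≤ x ᵅ

record ŁukasiewiczNearSemiring (a : Level) : Set (suc a) where
  field
    iota : IotaNearSemiring a
  open IotaNearSemiring iota public
  field
    łuk : ∀ x y → ((x · (y ᵅ)) ᵅ) · (y ᵅ) ≡ ((y · (x ᵅ)) ᵅ) · (x ᵅ)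

module _ {a : Level} (𝐀 : ŁukasiewiczNearSemiring a) where
  open ŁukasiewiczNearSemiring 𝐀

  record IsIdeal {ℓ : Level} (I : Pred Carrier ℓ) : Set (a ⊔ ℓ) where
    field
      zero∈ : 𝟘 ∈ I
      I1    : ∀ {x y} → (x · (y ᵅ)) ∈ I → y ∈ I → x ∈ I
      I2    : ∀ {x y} → ((x ᵅ) · y) ∈ I → ((y ᵅ) · x) ∈ I → ∀ c →
                (((x · c) ᵅ) · (y · c)) ∈ I × (((c · x) ᵅ) · (c · y)) ∈ I

  -- ⟨X⟩ : the least ideal containing X (intersection of all ideals
  -- (with level-a membership) containing X)
  ⟨_⟩ : Pred Carrier a → Pred Carrier (suc a)
  ⟨ X ⟩ x = (I : Pred Carrier a) → IsIdeal I → X ⊆ I → x ∈ I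

  θ : Pred Carrier a → Carrier → Carrier → Set a
  θ J x y = ((x ᵅ) · y) ∈ J × ((y ᵅ) · x) ∈ J

  [_]_ : Pred Carrier a → Pred Carrier a → Pred Carrier a
  [ I ] J = λ x → ∃[ i ] (i ∈ I × θ J x i)

module Submission where

-- Idea.  Łukasiewicz near semirings are congruence permutable: the term
--   malcev x y z = ((x yᵅ) ⊕ z) ⊓ ((z yᵅ) ⊕ x)
-- (with u ⊕ v = (uᵅ vᵅ)ᵅ and u ⊓ v = (uᵅ v)ᵅ v, the meet) satisfies
-- malcev x x z = z and malcev x z z = x.  Hence for congruences R, S the
-- composite R ; S is again a congruence.  For every congruence R the class
-- of 0 is an ideal, and for every ideal L the relation θ(L) is a congruence
-- whose class of 0 is L.  So [I]_θ(J), being the class of 0 of the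
-- congruence θ(J) ; θ(I), is an ideal; it contains I ∪ J, and it lies in
-- every ideal L ⊇ I ∪ J because L is closed under θ(J) ⊆ θ(L).

open import Defs
open import Level using (Level)
open import Relation.Unary using (Pred; _∪_; _≐_; _⊆_; _∈_)
open import Relation.Binary.Core using (Rel; _⇒_)
open import Relation.Binary.Structures using (IsEquivalence)
open import Relation.Binary.Construct.Composition using (_;_)
open import Relation.Binary.PropositionalEquality
  using (_≡_; sym; trans; cong; cong₂; subst; module ≡-Reasoning)
open import Data.Product using (_×_; _,_; proj₁; proj₂)
open import Data.Sum using (inj₁; inj₂)

module IotaNearSemiringProperties {a : Level} (𝐀 : IotaNearSemiring a) where
  open IotaNearSemiring 𝐀

  ≤-antisym : ∀ {x y} → x ≤ y → y ≤ x → x ≡ y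
  ≤-antisym {x} {y} x≤y y≤x = trans (sym y≤x) (trans (+-comm y x) x≤y)

  ≤-trans : ∀ {x y z} → x ≤ y → y ≤ z → x ≤ z
  ≤-trans {x} {y} {z} x≤y y≤z = begin
    x + z        ≡⟨ cong (x +_) (sym y≤z) ⟩
    x + (y + z)  ≡⟨ sym (+-assoc x y z) ⟩
    (x + y) + z  ≡⟨ cong (_+ z) x≤y ⟩
    y + z        ≡⟨ y≤z ⟩
    z            ∎
    where open ≡-Reasoning

  x≤x+y : ∀ x y → x ≤ x + y
  x≤x+y x y = trans (sym (+-assoc x x y)) (cong (_+ y) (+-idem x))

  y≤x+y : ∀ x y → y ≤ x + y
  y≤x+y x y = subst (y ≤_) (+-comm y x) (x≤x+y y x)

  +-lub : ∀ {x y z} → x ≤ z → y ≤ z → x + y ≤ z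
  +-lub {x} {y} {z} x≤z y≤z = trans (+-assoc x y z) (trans (cong (x +_) y≤z) x≤z)

  𝟘≤ : ∀ x → 𝟘 ≤ x
  𝟘≤ x = trans (+-comm 𝟘 x) (+-identity x)

  ·-monoˡ-≤ : ∀ {x y} z → x ≤ y → x · z ≤ y · z
  ·-monoˡ-≤ {x} {y} z x≤y = trans (sym (·-distribʳ x y z)) (cong (_· z) x≤y)

  -- α is an antitone involution, hence a Galois connection with itself.
  ᵅ-galois : ∀ {x y} → x ≤ y ᵅ → y ≤ x ᵅ
  ᵅ-galois {x} {y} x≤yᵅ = subst (_≤ x ᵅ) (ᵅ-invol y) (ᵅ-antitone x≤yᵅ)

  𝟙ᵅ : 𝟙 ᵅ ≡ 𝟘
  𝟙ᵅ = ≤-antisym (subst (𝟙 ᵅ ≤_) (ᵅ-invol 𝟘) (ᵅ-antitone (+-top (𝟘 ᵅ)))) (𝟘≤ (𝟙 ᵅ))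

  𝟘ᵅ : 𝟘 ᵅ ≡ 𝟙
  𝟘ᵅ = trans (cong _ᵅ (sym 𝟙ᵅ)) (ᵅ-invol 𝟙)

  𝟘ᵅ-identityˡ : ∀ x → 𝟘 ᵅ · x ≡ x
  𝟘ᵅ-identityˡ x = trans (cong (_· x) 𝟘ᵅ) (·-identityˡ x)

  -- The term operations behind the Mal'cev term: the "sum" ⊕ and the
  -- operation ⊓, which in a Łukasiewicz near semiring is the meet.
  infixl 6 _⊕_
  infixl 7 _⊓_

  _⊕_ : Carrier → Carrier → Carrier
  u ⊕ v = (u ᵅ · v ᵅ) ᵅ

  _⊓_ : Carrier → Carrier → Carrier
  u ⊓ v = (u ᵅ · v) ᵅ · v

  malcev : Carrier → Carrier → Carrier → Carrier
  malcev x y z = ((x · y ᵅ) ⊕ z) ⊓ ((z · y ᵅ) ⊕ x)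

  -- Congruences: equivalence relations compatible with α and with
  -- multiplication on both sides.
  record IsCongruence (R : Rel Carrier a) : Set a where
    field
      isEquivalence : IsEquivalence R
      ᵅ-cong        : ∀ {x y} → R x y → R (x ᵅ) (y ᵅ)
      ·-congʳ       : ∀ {x y} c → R x y → R (x · c) (y · c)
      ·-congˡ       : ∀ {x y} c → R x y → R (c · x) (c · y)

    open IsEquivalence isEquivalence public

    ·-cong : ∀ {x x′ y y′} → R x x′ → R y y′ → R (x · y) (x′ · y′)
    ·-cong {x′ = x′} {y = y} x~x′ y~y′ =
      IsEquivalence.trans isEquivalence (·-congʳ y x~x′) (·-congˡ x′ y~y′)

    ⊕-cong : ∀ {x x′ y y′} → R x x′ → R y y′ → R (x ⊕ y) (x′ ⊕ y′)
    ⊕-cong x~x′ y~y′ = ᵅ-cong (·-cong (ᵅ-cong x~x′) (ᵅ-cong y~y′))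

    ⊓-cong : ∀ {x x′ y y′} → R x x′ → R y y′ → R (x ⊓ y) (x′ ⊓ y′)
    ⊓-cong x~x′ y~y′ = ·-cong (ᵅ-cong (·-cong (ᵅ-cong x~x′) y~y′)) y~y′

    malcev-cong : ∀ {x x′ y y′ z z′} → R x x′ → R y y′ → R z z′ →
                  R (malcev x y z) (malcev x′ y′ z′)
    malcev-cong x~x′ y~y′ z~z′ =
      ⊓-cong (⊕-cong (·-cong x~x′ (ᵅ-cong y~y′)) z~z′)
             (⊕-cong (·-cong z~z′ (ᵅ-cong y~y′)) x~x′)

module ŁukasiewiczProperties {a : Level} (𝐀 : ŁukasiewiczNearSemiring a) where
  open ŁukasiewiczNearSemiring 𝐀
  open IotaNearSemiringProperties iota public

  -- x xᵅ = 0: the Łukasiewicz identity for the pair (𝟙, x).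
  ·-inverseʳ : ∀ x → x · x ᵅ ≡ 𝟘
  ·-inverseʳ x = begin
    x · x ᵅ                ≡⟨ cong (_· x ᵅ) (sym (ᵅ-invol x)) ⟩
    x ᵅ ᵅ · x ᵅ            ≡⟨ cong (λ t → t ᵅ · x ᵅ) (sym (·-identityˡ (x ᵅ))) ⟩
    (𝟙 · x ᵅ) ᵅ · x ᵅ      ≡⟨ łuk 𝟙 x ⟩
    (x · 𝟙 ᵅ) ᵅ · 𝟙 ᵅ      ≡⟨ cong ((x · 𝟙 ᵅ) ᵅ ·_) 𝟙ᵅ ⟩
    (x · 𝟙 ᵅ) ᵅ · 𝟘        ≡⟨ ·-zeroʳ _ ⟩
    𝟘                      ∎
    where open ≡-Reasoning

  ·-inverseˡ : ∀ x → x ᵅ · x ≡ 𝟘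
  ·-inverseˡ x = trans (cong (x ᵅ ·_) (sym (ᵅ-invol x))) (·-inverseʳ (x ᵅ))

  -- Both sides are compared by
  -- antisymmetry, using that r x y = (x yᵅ)ᵅ yᵅ is below yᵅ, antitone in x,
  -- and symmetric in x, y (the Łukasiewicz identity).
  łuk-join : ∀ x y → (x · y ᵅ) ᵅ · y ᵅ ≡ (x + y) ᵅ
  łuk-join x y = ≤-antisym r≤ ≤r
    where
    r : Carrier → Carrier → Carrier
    r u v = (u · v ᵅ) ᵅ · v ᵅ

    r≤ᵅ : ∀ u v → r u v ≤ v ᵅ
    r≤ᵅ u v = subst (r u v ≤_) (·-identityˡ (v ᵅ)) (·-monoˡ-≤ (v ᵅ) (+-top _))

    r-antitone : ∀ {u u′} v → u ≤ u′ → r u′ v ≤ r u v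
    r-antitone v u≤u′ = ·-monoˡ-≤ (v ᵅ) (ᵅ-antitone (·-monoˡ-≤ (v ᵅ) u≤u′))

    r-diagonal : ∀ u → r u u ≡ u ᵅ
    r-diagonal u = trans (cong (λ t → t ᵅ · u ᵅ) (·-inverseʳ u)) (𝟘ᵅ-identityˡ (u ᵅ))

    r≤ : r x y ≤ (x + y) ᵅ
    r≤ = subst (_≤ (x + y) ᵅ) (ᵅ-invol (r x y)) (ᵅ-antitone
           (+-lub (ᵅ-galois (subst (_≤ x ᵅ) (sym (łuk x y)) (r≤ᵅ y x)))
                  (ᵅ-galois (r≤ᵅ x y))))

    ≤r : (x + y) ᵅ ≤ r x y
    ≤r = ≤-trans (subst (_≤ r y (x + y)) (r-diagonal (x + y))
                   (r-antitone (x + y) (y≤x+y x y)))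
                 (subst (_≤ r x y) (sym (łuk y (x + y)))
                   (r-antitone y (x≤x+y x y)))

  ⊓-meet : ∀ u v → u ⊓ v ≡ (u ᵅ + v ᵅ) ᵅ
  ⊓-meet u v = trans (cong (λ t → (u ᵅ · t) ᵅ · t) (sym (ᵅ-invol v))) (łuk-join (u ᵅ) (v ᵅ))

  ⊓-comm : ∀ u v → u ⊓ v ≡ v ⊓ u
  ⊓-comm u v = trans (⊓-meet u v) (trans (cong _ᵅ (+-comm _ _)) (sym (⊓-meet v u)))

  ⊓-absorbs-+ : ∀ u w → u ⊓ (u + w) ≡ u
  ⊓-absorbs-+ u w = begin
    u ⊓ (u + w)                ≡⟨ ⊓-meet u (u + w) ⟩
    (u ᵅ + (u + w) ᵅ) ᵅ        ≡⟨ cong _ᵅ (+-comm (u ᵅ) ((u + w) ᵅ)) ⟩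
    ((u + w) ᵅ + u ᵅ) ᵅ        ≡⟨ cong _ᵅ (ᵅ-antitone (x≤x+y u w)) ⟩
    u ᵅ ᵅ                      ≡⟨ ᵅ-invol u ⟩
    u                          ∎
    where open ≡-Reasoning

  𝟘⊕ : ∀ z → 𝟘 ⊕ z ≡ z
  𝟘⊕ z = trans (cong _ᵅ (𝟘ᵅ-identityˡ (z ᵅ))) (ᵅ-invol z)

  residual-⊕ : ∀ u v → (u · v ᵅ) ⊕ v ≡ u + v
  residual-⊕ u v = trans (cong _ᵅ (łuk-join u v)) (ᵅ-invol (u + v))

  malcev-left : ∀ x z → malcev x x z ≡ z
  malcev-left x z =
    trans (cong₂ _⊓_ (trans (cong (_⊕ z) (·-inverseʳ x)) (𝟘⊕ z)) (residual-⊕ z x))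
          (⊓-absorbs-+ z x)

  malcev-right : ∀ x z → malcev x z z ≡ x
  malcev-right x z =
    trans (cong₂ _⊓_ (residual-⊕ x z) (trans (cong (_⊕ x) (·-inverseʳ z)) (𝟘⊕ x)))
          (trans (⊓-comm (x + z) x) (⊓-absorbs-+ x z))

  module _ {R S : Rel Carrier a} (R-cong : IsCongruence R) (S-cong : IsCongruence S) where
    private
      module R = IsCongruence R-cong
      module S = IsCongruence S-cong

    permute : (R ; S) ⇒ (S ; R)
    permute {x} {z} (y , x~y , y~z) =
      malcev x y z
      , S.sym (S.trans (S.malcev-cong S.refl y~z S.refl) (S.reflexive (malcev-right x z)))
      , R.trans (R.malcev-cong x~y R.refl R.refl) (R.reflexive (malcev-left y z))

  ;-isCongruence : ∀ {R S} → IsCongruence R → IsCongruence S → IsCongruence (R ; S)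
  ;-isCongruence {R} {S} R-cong S-cong = record
    { isEquivalence = record
      { refl  = λ {x} → x , R.refl , S.refl
      ; sym   = λ { (w , x~w , w~y) → permute S-cong R-cong (w , S.sym w~y , R.sym x~w) }
      ; trans = λ { (u , x~u , u~y) (v , y~v , v~z) →
                    let (w , u~w , w~v) = permute S-cong R-cong (_ , u~y , y~v)
                    in w , R.trans x~u u~w , S.trans w~v v~z }
      }
    ; ᵅ-cong  = λ { (w , x~w , w~y) → w ᵅ , R.ᵅ-cong x~w , S.ᵅ-cong w~y }
    ; ·-congʳ = λ { c (w , x~w , w~y) → w · c , R.·-congʳ c x~w , S.·-congʳ c w~y }
    ; ·-congˡ = λ { c (w , x~w , w~y) → c · w , R.·-congˡ c x~w , S.·-congˡ c w~y }
    }
    where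
    module R = IsCongruence R-cong
    module S = IsCongruence S-cong

  zeroClass : Rel Carrier a → Pred Carrier a
  zeroClass R x = R x 𝟘

  module _ {R : Rel Carrier a} (R-cong : IsCongruence R) where
    private module R = IsCongruence R-cong

    ⊓-from-difference : ∀ {x y} → R (x ᵅ · y) 𝟘 → R (x ⊓ y) y
    ⊓-from-difference {y = y} d =
      R.trans (R.·-congʳ y (R.ᵅ-cong d)) (R.reflexive (𝟘ᵅ-identityˡ y))

    related-by-differences : ∀ {x y} → R (x ᵅ · y) 𝟘 → R (y ᵅ · x) 𝟘 → R x y
    related-by-differences {x} {y} dxy dyx =
      R.trans (R.sym (⊓-from-difference dyx))
              (R.trans (R.reflexive (⊓-comm y x)) (⊓-from-difference dxy))

    zeroClass-isIdeal : IsIdeal 𝐀 (zeroClass R)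
    zeroClass-isIdeal = record { zero∈ = R.refl ; I1 = I1 ; I2 = I2 }
      where
      I1 : ∀ {x y} → R (x · y ᵅ) 𝟘 → R y 𝟘 → R x 𝟘
      I1 {x} {y} d y~𝟘 =
        R.trans (R.reflexive (trans (sym (·-identityʳ x)) (cong (x ·_) (sym 𝟘ᵅ))))
                (R.trans (R.·-congˡ x (R.ᵅ-cong (R.sym y~𝟘))) d)

      I2 : ∀ {x y} → R (x ᵅ · y) 𝟘 → R (y ᵅ · x) 𝟘 → ∀ c →
           R ((x · c) ᵅ · (y · c)) 𝟘 × R ((c · x) ᵅ · (c · y)) 𝟘
      I2 {x} {y} dxy dyx c =
          R.trans (R.·-congʳ (y · c) (R.ᵅ-cong (R.·-congʳ c x~y)))
                  (R.reflexive (·-inverseˡ (y · c)))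
        , R.trans (R.·-congʳ (c · y) (R.ᵅ-cong (R.·-congˡ c x~y)))
                  (R.reflexive (·-inverseˡ (c · y)))
        where
        x~y : R x y
        x~y = related-by-differences dxy dyx

  IsIdeal-resp-≐ : ∀ {P Q : Pred Carrier a} → P ≐ Q → IsIdeal 𝐀 P → IsIdeal 𝐀 Q
  IsIdeal-resp-≐ (P⊆Q , Q⊆P) isP = record
    { zero∈ = P⊆Q zero∈
    ; I1    = λ d y∈Q → P⊆Q (I1 (Q⊆P d) (Q⊆P y∈Q))
    ; I2    = λ dxy dyx c → let (r , l) = I2 (Q⊆P dxy) (Q⊆P dyx) c in P⊆Q r , P⊆Q l
    }
    where open IsIdeal isP

  module IdealCongruence {L : Pred Carrier a} (isL : IsIdeal 𝐀 L) where
    open IsIdeal isL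

    -- x θ(L) y implies x yᵅ ∈ L: apply I2 to (y, x) with c = yᵅ.
    θ-residual : ∀ {x y} → θ 𝐀 L x y → x · y ᵅ ∈ L
    θ-residual {x} {y} (dxy , dyx) = subst L cancel (proj₁ (I2 dyx dxy (y ᵅ)))
      where
      cancel : (y · y ᵅ) ᵅ · (x · y ᵅ) ≡ x · y ᵅ
      cancel = trans (cong (λ t → t ᵅ · (x · y ᵅ)) (·-inverseʳ y)) (𝟘ᵅ-identityˡ (x · y ᵅ))

    θ-closed : ∀ {x y} → θ 𝐀 L x y → y ∈ L → x ∈ L
    θ-closed x~y y∈L = I1 (θ-residual x~y) y∈L

    θ-isCongruence : IsCongruence (θ 𝐀 L)
    θ-isCongruence = record
      { isEquivalence = record { refl = θ-refl ; sym = θ-sym ; trans = θ-trans }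
      ; ᵅ-cong  = θ-ᵅ
      ; ·-congʳ = θ-·ʳ
      ; ·-congˡ = λ c (dxy , dyx) → proj₂ (I2 dxy dyx c) , proj₂ (I2 dyx dxy c)
      }
      where
      θ-·ʳ : ∀ {x y} c → θ 𝐀 L x y → θ 𝐀 L (x · c) (y · c)
      θ-·ʳ c (dxy , dyx) = proj₁ (I2 dxy dyx c) , proj₁ (I2 dyx dxy c)

      θ-refl : ∀ {x} → θ 𝐀 L x x
      θ-refl {x} = subst L (sym (·-inverseˡ x)) zero∈ , subst L (sym (·-inverseˡ x)) zero∈

      θ-sym : ∀ {x y} → θ 𝐀 L x y → θ 𝐀 L y x
      θ-sym (dxy , dyx) = dyx , dxy

      θ-ᵅ : ∀ {x y} → θ 𝐀 L x y → θ 𝐀 L (x ᵅ) (y ᵅ)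
      θ-ᵅ {x} {y} x~y =
          subst (λ t → t · y ᵅ ∈ L) (sym (ᵅ-invol x)) (θ-residual x~y)
        , subst (λ t → t · x ᵅ ∈ L) (sym (ᵅ-invol y)) (θ-residual (θ-sym x~y))

      -- xᵅ z ∈ L because xᵅ z θ(L) yᵅ z ∈ L, and symmetrically.
      θ-trans : ∀ {x y z} → θ 𝐀 L x y → θ 𝐀 L y z → θ 𝐀 L x z
      θ-trans {x} {y} {z} x~y y~z =
          θ-closed (θ-·ʳ z (θ-ᵅ x~y)) (proj₁ y~z)
        , θ-closed (θ-·ʳ x (θ-ᵅ (θ-sym y~z))) (proj₂ x~y)

    θ-zeroClass : L ≐ zeroClass (θ 𝐀 L)
    θ-zeroClass =
        (λ {x} x∈L → subst L (sym (·-zeroʳ (x ᵅ))) zero∈ , subst L (sym (𝟘ᵅ-identityˡ x)) x∈L)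
      , (λ {x} (_ , d) → subst L (𝟘ᵅ-identityˡ x) d)

  module Saturation {I J : Pred Carrier a} (isI : IsIdeal 𝐀 I) (isJ : IsIdeal 𝐀 J) where
    private
      module ℐ = IdealCongruence isI
      module 𝒥 = IdealCongruence isJ

    saturation-zeroClass : [_]_ 𝐀 I J ≐ zeroClass (θ 𝐀 J ; θ 𝐀 I)
    saturation-zeroClass =
        (λ (i , i∈I , x~i) → i , x~i , proj₁ ℐ.θ-zeroClass i∈I)
      , (λ (w , x~w , w~𝟘) → w , proj₂ ℐ.θ-zeroClass w~𝟘 , x~w)

    saturation-isIdeal : IsIdeal 𝐀 ([_]_ 𝐀 I J)
    saturation-isIdeal =
      IsIdeal-resp-≐ (proj₂ saturation-zeroClass , proj₁ saturation-zeroClass)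
        (zeroClass-isIdeal (;-isCongruence 𝒥.θ-isCongruence ℐ.θ-isCongruence))

    -- I ⊆ [I]_θ(J) by reflexivity, and J ⊆ [I]_θ(J) since j θ(J) 0 ∈ I.
    ∪⊆saturation : I ∪ J ⊆ [_]_ 𝐀 I J
    ∪⊆saturation {x} (inj₁ x∈I) = x , x∈I , IsCongruence.refl 𝒥.θ-isCongruence
    ∪⊆saturation (inj₂ x∈J) = 𝟘 , IsIdeal.zero∈ isI , proj₁ 𝒥.θ-zeroClass x∈J

    -- An ideal L ⊇ I ∪ J has θ(J) ⊆ θ(L) and is closed under θ(L).
    saturation⊆ideal : ∀ {L} → IsIdeal 𝐀 L → I ∪ J ⊆ L → [_]_ 𝐀 I J ⊆ L
    saturation⊆ideal isL I∪J⊆L (i , i∈I , (dxi , dix)) =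
      IdealCongruence.θ-closed isL (I∪J⊆L (inj₂ dxi) , I∪J⊆L (inj₂ dix)) (I∪J⊆L (inj₁ i∈I))

proposition3 : ∀ {a : Level} (𝐀 : ŁukasiewiczNearSemiring a)
                 (I J : Pred (ŁukasiewiczNearSemiring.Carrier 𝐀) a) →
                 IsIdeal 𝐀 I → IsIdeal 𝐀 J →
                 ⟨_⟩ 𝐀 (I ∪ J) ≐ [_]_ 𝐀 I J
proposition3 𝐀 I J isI isJ =
    (λ x∈⟨I∪J⟩ → x∈⟨I∪J⟩ ([_]_ 𝐀 I J) saturation-isIdeal ∪⊆saturation)
  , (λ x∈[I]J L isL I∪J⊆L → saturation⊆ideal isL I∪J⊆L x∈[I]J)
  where open ŁukasiewiczProperties.Saturation 𝐀 isI isJ
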